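{- Let $\mathcal{P}$ be a chiral $n$-polytope and $\mathcal{Q}$ a directly regular $n$-polytope, with associated normal subgroups $M$ and $K$ of $W^+$, and let $N=M\cap K$ be the normal subgroup associated with the mix $\mathcal P\diamondsuit\mathcal Q$. Then the chirality group $X(\mathcal{P}\diamondsuit\mathcal{Q})$ is isomorphic to $(M^{r_0}\cap K)M/M$, which is a normal subgroup of $X(\mathcal{P})=M^{r_0}M/M$. Moreover, $X(\mathcal{P}\diamondsuit\mathcal{Q})$ is trivial if and only if $M\cap K\le M^{r_0}$. In particular, if $\mathcal{P}\diamondsuit\mathcal{Q}$ is directly regular, then $\mathcal{P}\diamondsuit\mathcal{Q}$ covers the smallest regular cover $\mathcal{P}_W$ of $\mathcal{P}$ (that is, $N\le M_W$).
   Context: $W$ is the group with generators $r_0,\dots,r_{n-1}$ and relations $r_i^2=(r_ir_j)^2=\epsilon$ for $|i-j|\ge2$; $W^+=\langle s_i=r_{i-1}r_i: 1\le i\le n-1\rangle$. For a chiral $\mathcal P$ with distinguished rotation generators $\sigma_i$ of $\Gamma(\mathcal P)=:\Gamma^+(\mathcal P)$, or a directly regular $\mathcal Q$ with rotation generators $\sigma'_i=\rho_{i-1}\rho_i$ of $\Gamma^+(\mathcal Q)$, the associated normal subgroup is the kernel $M$ (resp. $K$) of $s_i\mapsto\sigma_i$ (resp. $s_i\mapsto\sigma_i'$); $K$ is normal in $W$. The mix group $\Gamma^+(\mathcal P)\diamondsuit\Gamma^+(\mathcal Q)$ (subgroup of the direct product generated by $(\sigma_i,\sigma_i')$) is $W^+/N$.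 For a normal subgroup $L$ of $W^+$ write $L^{r_0}=r_0Lr_0^{ -1}$, $L_W=L\cap L^{r_0}$, $L^W=LL^{r_0}$; the chirality group of the object associated with $L$ is $X=L^W/L\cong L^{r_0}/L_W$. $\mathcal P_W$ denotes the object associated with $M_W$, i.e. the quotient $\mathcal U/M_W$ of the universal polytope $\mathcal U=\{\infty,\dots,\infty\}$ (whose group is $W$); for normal subgroups $L\le L'$ of $W^+$, $\mathcal U/L$ covers $\mathcal U/L'$. -}

module Defs where

open import Data.Nat using (ℕ; suc; _+_; _≤_)
open import Data.Fin using (Fin; toℕ; zero)
open import Data.List using (List; []; _∷_; _++_; reverse; length)
open import Data.Product using (Σ; ∃; _×_; _,_; proj₁)
open import Data.Sum using (_⊎_)
open import Data.Empty using (⊥)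
open import Relation.Nullary using (¬_)
open import Function.Bundles using (_⇔_)

-- The group W = ⟨ r₀ … r_{n-1} | r_i² = (r_i r_j)² = ε  (|i-j| ≥ 2) ⟩
-- presented as words (lists of generator indices) modulo the congruence
-- generated by the defining relations.
-- Since every generator is an involution, the inverse of a word is its
-- reverse.

Word : ℕ → Set
Word n = List (Fin n)

data _~_ {n : ℕ} : Word n → Word n → Set where
  ~-refl  : ∀ {u} → u ~ u
  ~-sym   : ∀ {u v} → u ~ v → v ~ u
  ~-trans : ∀ {u v w} → u ~ v → v ~ w → u ~ w
  ~-cong  : ∀ {u u' v v'} → u ~ u' → v ~ v' → (u ++ v) ~ (u' ++ v')
  ~-inv   : ∀ i → (i ∷ i ∷ []) ~ []
  ~-comm  : ∀ i j → (toℕ i + 2 ≤ toℕ j ⊎ toℕ j + 2 ≤ toℕ i) →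
            (i ∷ j ∷ i ∷ j ∷ []) ~ []

_⁻¹ʷ : ∀ {n} → Word n → Word n
w ⁻¹ʷ = reverse w

-- the rotation subgroup W⁺ (generated by s_i = r_{i-1} r_i) consists
-- exactly of the words of even length
data Even : ℕ → Set where
  ev0 : Even 0
  ev2 : ∀ {k} → Even k → Even (suc (suc k))

InW⁺ : ∀ {n} → Word n → Set
InW⁺ w = Even (length w)

Pred : ℕ → Set₁
Pred n = Word n → Set

_⊆_ : ∀ {n} → Pred n → Pred n → Set
A ⊆ B = ∀ w → A w → B w

_∩_ : ∀ {n} → Pred n → Pred n → Pred n
(A ∩ B) w = A w × B w

_·_ : ∀ {n} → Pred n → Pred n → Pred n
(A · B) w = Σ _ λ a → Σ _ λ b → A a × B b × (w ~ (a ++ b))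

record IsSubgroup {n} (L : Pred n) : Set where
  field
    resp  : ∀ {u v} → u ~ v → L u → L v
    unit  : L []
    mul   : ∀ {u v} → L u → L v → L (u ++ v)
    inv   : ∀ {u} → L u → L (u ⁻¹ʷ)

record IsNormalInW⁺ {n} (L : Pred n) : Set where
  field
    subgroup : IsSubgroup L
    inW⁺     : L ⊆ InW⁺
    conj     : ∀ g {w} → InW⁺ g → L w → L (g ++ w ++ g ⁻¹ʷ)

record IsNormalInW {n} (L : Pred n) : Set where
  field
    subgroup : IsSubgroup L
    inW⁺     : L ⊆ InW⁺
    conj     : ∀ g {w} → L w → L (g ++ w ++ g ⁻¹ʷ)

record IsNormalSubgroupOf {n} (A B : Pred n) : Set where
  field
    subgroupA : IsSubgroup A
    A⊆B       : A ⊆ B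
    conj      : ∀ g {w} → B g → A w → A (g ++ w ++ g ⁻¹ʷ)

module _ {m : ℕ} where
  r₀ : Fin (suc m)
  r₀ = zero

  _^r₀ : Pred (suc m) → Pred (suc m)
  (L ^r₀) w = L (r₀ ∷ w ++ r₀ ∷ [])

  -- L_W = L ∩ L^{r₀},  L^W = L L^{r₀}
  _W↓ : Pred (suc m) → Pred (suc m)
  L W↓ = L ∩ (L ^r₀)

  _W↑ : Pred (suc m) → Pred (suc m)
  L W↑ = L · (L ^r₀)

-- Subquotients H/N (N ⊆ H normal in H), elements = elements of H,
-- x ≡ y  iff  x y⁻¹ ∈ N.

module _ {n : ℕ} where
  Elt : Pred n → Set
  Elt H = Σ (Word n) H

  _≈[_]_ : ∀ {H : Pred n} → Elt H → Pred n → Elt H → Set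
  (x , _) ≈[ N ] (y , _) = N (x ++ y ⁻¹ʷ)

  record Iso (H₁ N₁ H₂ N₂ : Pred n) : Set where
    field
      f       : Elt H₁ → Elt H₂
      f-cong  : ∀ x y → x ≈[ N₁ ] y → f x ≈[ N₂ ] f y
      f-hom   : ∀ (x y : Elt H₁) (p : H₁ (proj₁ x ++ proj₁ y)) →
                N₂ (proj₁ (f (proj₁ x ++ proj₁ y , p))
                    ++ (proj₁ (f x) ++ proj₁ (f y)) ⁻¹ʷ)
      f-inj   : ∀ x y → f x ≈[ N₂ ] f y → x ≈[ N₁ ] y
      f-surj  : ∀ y → Σ (Elt H₁) λ x → f x ≈[ N₂ ] y

  TrivialQuot : Pred n → Pred n → Set
  TrivialQuot H N = H ⊆ N

module _ {m : ℕ} where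
  -- the object associated with L is directly regular iff L is normal in W,
  -- i.e. L = L^{r₀}
  DirectlyRegular : Pred (suc m) → Set
  DirectlyRegular L = ∀ w → L w ⇔ (L ^r₀) w

  Chiral : Pred (suc m) → Set
  Chiral L = ¬ DirectlyRegular L

-- Write x ∈ N^W = N N^{r₀} as x = a b with a ∈ N and b ∈ N^{r₀}.  Since K is normal in W, K^{r₀} = K, so
-- b ∈ M^{r₀} ∩ K.  The map x ↦ b is a homomorphism N^W/N → (M^{r₀} ∩ K)M/M because b ∈ W⁺ normalises M,
-- and it is injective because b, b' ∈ K, so b b'⁻¹ ∈ M already lies in N.  Normality in M^{r₀}M holds
-- because M^{r₀} ∩ K is normal in M^{r₀} and M^{r₀} ⊆ W⁺ normalises M.  Finally L^W/L is trivial iff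
-- L ⊆ L^{r₀}, which for L = M ∩ K means N ⊆ M^{r₀}, again because K^{r₀} = K.
module Submission where

open import Defs
open import Data.Nat using (ℕ; suc; _≤_)
open import Data.Nat.Properties using (+-comm)
import Data.Nat as ℕ
open import Data.Bool using (Bool; true; false; not)
open import Data.List using (List; []; _∷_; _++_; reverse; length)
open import Data.List.Properties
  using (reverse-++; unfold-reverse; reverse-involutive; length-++; ++-assoc; ++-identityʳ)
open import Data.Product using (_×_; _,_; proj₁; proj₂; Σ)
open import Data.Sum using () renaming (swap to ⊎-swap)
open import Function.Bundles using (_⇔_; mk⇔; Equivalence)
open import Function.Properties.Equivalence using () renaming (trans to ⇔-trans)
open import Relation.Binary.PropositionalEquality using (_≡_; refl; sym; trans; cong; cong₂; subst)
open import Relation.Nullary using (yes; no)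

module _ {n : ℕ} where

  ≡⇒~ : {u v : Word n} → u ≡ v → u ~ v
  ≡⇒~ refl = ~-refl

  ⁻¹ʷ-resp-~ : {u v : Word n} → u ~ v → (u ⁻¹ʷ) ~ (v ⁻¹ʷ)
  ⁻¹ʷ-resp-~ ~-refl        = ~-refl
  ⁻¹ʷ-resp-~ (~-sym p)     = ~-sym (⁻¹ʷ-resp-~ p)
  ⁻¹ʷ-resp-~ (~-trans p q) = ~-trans (⁻¹ʷ-resp-~ p) (⁻¹ʷ-resp-~ q)
  ⁻¹ʷ-resp-~ (~-cong {u} {u'} {v} {v'} p q) =
    ~-trans (≡⇒~ (reverse-++ u v))
      (~-trans (~-cong (⁻¹ʷ-resp-~ q) (⁻¹ʷ-resp-~ p)) (≡⇒~ (sym (reverse-++ u' v'))))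
  ⁻¹ʷ-resp-~ (~-inv i)      = ~-inv i
  ⁻¹ʷ-resp-~ (~-comm i j p) = ~-comm j i (⊎-swap p)

  ++-inverseʳ : (w : Word n) → (w ++ w ⁻¹ʷ) ~ []
  ++-inverseʳ []      = ~-refl
  ++-inverseʳ (x ∷ w) =
    ~-trans (≡⇒~ (cong (x ∷_) (trans (cong (w ++_) (unfold-reverse x w))
                                      (sym (++-assoc w (reverse w) (x ∷ []))))))
      (~-trans (~-cong (~-refl {u = x ∷ []}) (~-cong (++-inverseʳ w) (~-refl {u = x ∷ []})))
        (~-inv x))

  ++-inverseˡ : (w : Word n) → (w ⁻¹ʷ ++ w) ~ []
  ++-inverseˡ w =
    ~-trans (≡⇒~ (cong (reverse w ++_) (sym (reverse-involutive w)))) (++-inverseʳ (reverse w))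

  cancel-prefix : ∀ a b {c : Word n} → (a ++ b) ~ [] → (a ++ b ++ c) ~ c
  cancel-prefix a b p = ~-trans (≡⇒~ (sym (++-assoc a b _))) (~-cong p ~-refl)

-- Equalities in W between products of words and their inverses that hold in every group are decided
-- by free reduction of the flattened expressions.
module WordSolver {n : ℕ} where

  infixr 5 _⊕_

  data Expr : Set where
    var : ℕ → Expr
    _⊕_ : Expr → Expr → Expr
    ι   : Expr → Expr
    ε   : Expr

  -- variables beyond the end of the environment denote the empty word
  _‼_ : List (Word n) → ℕ → Word n
  []      ‼ _     = []
  (w ∷ _) ‼ 0     = w
  (_ ∷ ρ) ‼ suc i = ρ ‼ i

  ⟦_⟧ : Expr → List (Word n) → Word n
  ⟦ var i ⟧ ρ = ρ ‼ i
  ⟦ a ⊕ b ⟧ ρ = ⟦ a ⟧ ρ ++ ⟦ b ⟧ ρ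
  ⟦ ι a ⟧   ρ = ⟦ a ⟧ ρ ⁻¹ʷ
  ⟦ ε ⟧     ρ = []

  -- a literal is a variable together with a sign (false for an inverse)
  Literal : Set
  Literal = ℕ × Bool

  ⟦_⟧ᴸ : Literal → List (Word n) → Word n
  ⟦ i , true  ⟧ᴸ ρ = ρ ‼ i
  ⟦ i , false ⟧ᴸ ρ = (ρ ‼ i) ⁻¹ʷ

  ⟦_⟧ᴸ* : List Literal → List (Word n) → Word n
  ⟦ [] ⟧ᴸ*    ρ = []
  ⟦ l ∷ ls ⟧ᴸ* ρ = ⟦ l ⟧ᴸ ρ ++ ⟦ ls ⟧ᴸ* ρ

  invert : List Literal → List Literal
  invert []             = []
  invert ((i , s) ∷ ls) = invert ls ++ (i , not s) ∷ []

  flatten : Expr → List Literal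
  flatten (var i) = (i , true) ∷ []
  flatten (a ⊕ b) = flatten a ++ flatten b
  flatten (ι a)   = invert (flatten a)
  flatten ε       = []

  consReduce : Literal → List Literal → List Literal
  consReduce l [] = l ∷ []
  consReduce (i , s) ((j , t) ∷ ls) with i ℕ.≟ j | s | t
  ... | yes refl | true  | false = ls
  ... | yes refl | false | true  = ls
  ... | _        | _     | _     = (i , s) ∷ (j , t) ∷ ls

  reduce : List Literal → List Literal
  reduce []       = []
  reduce (l ∷ ls) = consReduce l (reduce ls)

  normalise : Expr → List Literal
  normalise e = reduce (flatten e)

  ⟦⟧ᴸ*-++ : ∀ ρ ls ks → ⟦ ls ++ ks ⟧ᴸ* ρ ≡ ⟦ ls ⟧ᴸ* ρ ++ ⟦ ks ⟧ᴸ* ρ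
  ⟦⟧ᴸ*-++ ρ []       ks = refl
  ⟦⟧ᴸ*-++ ρ (l ∷ ls) ks =
    trans (cong (⟦ l ⟧ᴸ ρ ++_) (⟦⟧ᴸ*-++ ρ ls ks)) (sym (++-assoc (⟦ l ⟧ᴸ ρ) (⟦ ls ⟧ᴸ* ρ) (⟦ ks ⟧ᴸ* ρ)))

  ⟦⟧ᴸ*-invert : ∀ ρ ls → ⟦ invert ls ⟧ᴸ* ρ ≡ ⟦ ls ⟧ᴸ* ρ ⁻¹ʷ
  ⟦⟧ᴸ*-invert ρ [] = refl
  ⟦⟧ᴸ*-invert ρ ((i , s) ∷ ls) =
    trans (⟦⟧ᴸ*-++ ρ (invert ls) _)
      (trans (cong₂ _++_ (⟦⟧ᴸ*-invert ρ ls) (trans (++-identityʳ _) (negate s)))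
        (sym (reverse-++ (⟦ i , s ⟧ᴸ ρ) (⟦ ls ⟧ᴸ* ρ))))
    where
    negate : ∀ s → ⟦ i , not s ⟧ᴸ ρ ≡ ⟦ i , s ⟧ᴸ ρ ⁻¹ʷ
    negate true  = refl
    negate false = sym (reverse-involutive (ρ ‼ i))

  flatten-sound : ∀ ρ e → ⟦ flatten e ⟧ᴸ* ρ ≡ ⟦ e ⟧ ρ
  flatten-sound ρ (var i) = ++-identityʳ (ρ ‼ i)
  flatten-sound ρ (a ⊕ b) =
    trans (⟦⟧ᴸ*-++ ρ (flatten a) (flatten b)) (cong₂ _++_ (flatten-sound ρ a) (flatten-sound ρ b))
  flatten-sound ρ (ι a)   = trans (⟦⟧ᴸ*-invert ρ (flatten a)) (cong reverse (flatten-sound ρ a))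
  flatten-sound ρ ε       = refl

  consReduce-sound : ∀ ρ l ls → ⟦ consReduce l ls ⟧ᴸ* ρ ~ (⟦ l ⟧ᴸ ρ ++ ⟦ ls ⟧ᴸ* ρ)
  consReduce-sound ρ l [] = ~-refl
  consReduce-sound ρ (i , s) ((j , t) ∷ ls) with i ℕ.≟ j | s | t
  ... | yes refl | true  | false = ~-sym (cancel-prefix (ρ ‼ i) _ (++-inverseʳ (ρ ‼ i)))
  ... | yes refl | false | true  = ~-sym (cancel-prefix ((ρ ‼ i) ⁻¹ʷ) _ (++-inverseˡ (ρ ‼ i)))
  ... | yes refl | true  | true  = ~-refl
  ... | yes refl | false | false = ~-refl
  ... | no _     | _     | _     = ~-refl

  normalise-sound : ∀ ρ e → ⟦ normalise e ⟧ᴸ* ρ ~ ⟦ e ⟧ ρ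
  normalise-sound ρ e = ~-trans (reduce-sound (flatten e)) (≡⇒~ (flatten-sound ρ e))
    where
    reduce-sound : ∀ ls → ⟦ reduce ls ⟧ᴸ* ρ ~ ⟦ ls ⟧ᴸ* ρ
    reduce-sound []       = ~-refl
    reduce-sound (l ∷ ls) =
      ~-trans (consReduce-sound ρ l (reduce ls)) (~-cong ~-refl (reduce-sound ls))

  solve : (e₁ e₂ : Expr) → normalise e₁ ≡ normalise e₂ → ∀ ρ → ⟦ e₁ ⟧ ρ ~ ⟦ e₂ ⟧ ρ
  solve e₁ e₂ eq ρ =
    ~-trans (~-sym (normalise-sound ρ e₁))
      (~-trans (≡⇒~ (cong (λ ls → ⟦ ls ⟧ᴸ* ρ) eq)) (normalise-sound ρ e₂))

  x₀ x₁ x₂ x₃ x₄ : Expr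
  x₀ = var 0
  x₁ = var 1
  x₂ = var 2
  x₃ = var 3
  x₄ = var 4

open WordSolver using (solve; _⊕_; ι; ε; x₀; x₁; x₂; x₃; x₄)

module _ {n : ℕ} where
  open IsSubgroup

  Normalises : Pred n → Pred n → Set
  Normalises G L = ∀ g {w} → G g → L w → L (g ++ w ++ g ⁻¹ʷ)

  ∩-subgroup : {A B : Pred n} → IsSubgroup A → IsSubgroup B → IsSubgroup (A ∩ B)
  resp (∩-subgroup sA sB) e (a , b)        = resp sA e a , resp sB e b
  unit (∩-subgroup sA sB)                  = unit sA , unit sB
  mul  (∩-subgroup sA sB) (a , b) (a' , b') = mul sA a a' , mul sB b b'
  inv  (∩-subgroup sA sB) (a , b)          = inv sA a , inv sB b

  normalises-∩-normalInW : {A K : Pred n} → IsSubgroup A → IsNormalInW K → Normalises A (A ∩ K)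
  normalises-∩-normalInW sA hK g ag (aw , kw) =
    mul sA ag (mul sA aw (inv sA ag)) , IsNormalInW.conj hK g kw

  ·-subgroup : {H L : Pred n} → IsSubgroup H → IsSubgroup L → Normalises H L → IsSubgroup (H · L)
  resp (·-subgroup sH sL nL) e (h , l , hh , ll , eu) = h , l , hh , ll , ~-trans (~-sym e) eu
  unit (·-subgroup sH sL nL) = [] , [] , unit sH , unit sL , ~-refl
  mul  (·-subgroup sH sL nL) (h , l , hh , ll , eu) (h' , l' , hh' , ll' , ev) =
    h ++ h' , (h' ⁻¹ʷ ++ l ++ h' ⁻¹ʷ ⁻¹ʷ) ++ l' ,
    mul sH hh hh' , mul sL (nL (h' ⁻¹ʷ) (inv sH hh') ll) ll' ,
    ~-trans (~-cong eu ev)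
      (solve ((x₀ ⊕ x₁) ⊕ (x₂ ⊕ x₃)) ((x₀ ⊕ x₂) ⊕ ((ι x₂ ⊕ x₁ ⊕ ι (ι x₂)) ⊕ x₃))
             refl (h ∷ l ∷ h' ∷ l' ∷ []))
  inv  (·-subgroup sH sL nL) (h , l , hh , ll , eu) =
    h ⁻¹ʷ , h ++ l ⁻¹ʷ ++ h ⁻¹ʷ , inv sH hh , nL h hh (inv sL ll) ,
    ~-trans (⁻¹ʷ-resp-~ eu) (solve (ι (x₀ ⊕ x₁)) (ι x₀ ⊕ x₀ ⊕ ι x₁ ⊕ ι x₀) refl (h ∷ l ∷ []))

  ·-normal : {C D L : Pred n} → IsSubgroup C → IsSubgroup L → C ⊆ D →
             Normalises D C → Normalises D L → IsNormalSubgroupOf (C · L) (D · L)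
  ·-normal {C} {D} {L} sC sL C⊆D nC nL = record
    { subgroupA = ·-subgroup sC sL (λ g cg → nL g (C⊆D g cg))
    ; A⊆B       = λ { w (c , l , cc , ll , e) → c , l , C⊆D c cc , ll , e }
    ; conj      = conj
    }
    where
    conj : Normalises (D · L) (C · L)
    conj g {w} (d , k , dd , kk , eg) (c , l , cc , ll , ew) =
      d ++ c ++ d ⁻¹ʷ ,
      d ++ ((c ⁻¹ʷ ++ k ++ c ⁻¹ʷ ⁻¹ʷ) ++ l ++ k ⁻¹ʷ) ++ d ⁻¹ʷ ,
      nC d dd cc ,
      nL d dd (mul sL (nL (c ⁻¹ʷ) (C⊆D _ (inv sC cc)) kk) (mul sL ll (inv sL kk))) ,
      ~-trans (~-cong eg (~-cong ew (⁻¹ʷ-resp-~ eg)))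
        (solve ((x₀ ⊕ x₁) ⊕ (x₂ ⊕ x₃) ⊕ ι (x₀ ⊕ x₁))
               ((x₀ ⊕ x₂ ⊕ ι x₀) ⊕ x₀ ⊕ ((ι x₂ ⊕ x₁ ⊕ ι (ι x₂)) ⊕ x₃ ⊕ ι x₁) ⊕ ι x₀)
               refl (d ∷ k ∷ c ∷ l ∷ []))

module _ {m : ℕ} where
  open IsSubgroup

  conjr₀ : Word (suc m) → Word (suc m)
  conjr₀ w = r₀ ∷ w ++ r₀ ∷ []

  -- the one-letter word r₀ is its own inverse word, so conjr₀ is conjugation x ↦ r x r⁻¹ with r = r₀ ∷ []
  conjr₀-involutive : (w : Word (suc m)) → conjr₀ (conjr₀ w) ~ w
  conjr₀-involutive w = solve (x₁ ⊕ (ι x₁ ⊕ x₀ ⊕ x₁) ⊕ ι x₁) x₀ refl (w ∷ (r₀ ∷ []) ∷ [])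

  ^r₀-subgroup : {L : Pred (suc m)} → IsSubgroup L → IsSubgroup (L ^r₀)
  resp (^r₀-subgroup sL) e = resp sL (~-cong (~-refl {u = r₀ ∷ []}) (~-cong e ~-refl))
  unit (^r₀-subgroup sL) = resp sL (solve ε (x₀ ⊕ ι x₀) refl ((r₀ ∷ []) ∷ [])) (unit sL)
  mul  (^r₀-subgroup sL) {u} {v} p q = resp sL
    (solve ((x₀ ⊕ x₁ ⊕ ι x₀) ⊕ (x₀ ⊕ x₂ ⊕ ι x₀)) (x₀ ⊕ (x₁ ⊕ x₂) ⊕ ι x₀) refl ((r₀ ∷ []) ∷ u ∷ v ∷ []))
    (mul sL p q)
  inv  (^r₀-subgroup sL) {u} p = resp sL
    (solve (ι (x₀ ⊕ x₁ ⊕ ι x₀)) (x₀ ⊕ ι x₁ ⊕ ι x₀) refl ((r₀ ∷ []) ∷ u ∷ []))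
    (inv sL p)

  ^r₀-⊆W⁺ : {L : Pred (suc m)} → L ⊆ InW⁺ → (L ^r₀) ⊆ InW⁺
  ^r₀-⊆W⁺ L⊆W⁺ w lw =
    even-pred (subst (λ k → Even (suc k)) (trans (length-++ w) (+-comm (length w) 1)) (L⊆W⁺ _ lw))
    where
    even-pred : ∀ {k} → Even (suc (suc k)) → Even k
    even-pred (ev2 e) = e

  normalInW⇒⊆^r₀ : {K : Pred (suc m)} → IsNormalInW K → K ⊆ (K ^r₀)
  normalInW⇒⊆^r₀ hK w = IsNormalInW.conj hK (r₀ ∷ [])

  normalInW⇒^r₀⊆ : {K : Pred (suc m)} → IsNormalInW K → (K ^r₀) ⊆ K
  normalInW⇒^r₀⊆ hK w k =
    resp (IsNormalInW.subgroup hK) (conjr₀-involutive w) (normalInW⇒⊆^r₀ hK (conjr₀ w) k)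

  W↑-trivial⇔⊆^r₀ : {L : Pred (suc m)} → IsSubgroup L → TrivialQuot (L W↑) L ⇔ (L ⊆ (L ^r₀))
  W↑-trivial⇔⊆^r₀ {L} sL = mk⇔ to from
    where
    to : TrivialQuot (L W↑) L → L ⊆ (L ^r₀)
    to T w lw = T (conjr₀ w) ([] , conjr₀ w , unit sL , resp sL (~-sym (conjr₀-involutive w)) lw , ~-refl)

    from : L ⊆ (L ^r₀) → TrivialQuot (L W↑) L
    from S w (a , b , la , lb^r₀ , e) =
      resp sL (~-sym e) (mul sL la (resp sL (conjr₀-involutive b) (S (conjr₀ b) lb^r₀)))

  ∩-⊆^r₀⇔ : {M K : Pred (suc m)} → K ⊆ (K ^r₀) → ((M ∩ K) ⊆ ((M ∩ K) ^r₀)) ⇔ ((M ∩ K) ⊆ (M ^r₀))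
  ∩-⊆^r₀⇔ K⊆K^r₀ = mk⇔ (λ S w x → proj₁ (S w x)) (λ S w x → S w x , K⊆K^r₀ w (proj₂ x))

  W↓-mono : {A B : Pred (suc m)} → A ⊆ B → (A W↓) ⊆ (B W↓)
  W↓-mono A⊆B w (a , a^r₀) = A⊆B w a , A⊆B (conjr₀ w) a^r₀

  directlyRegular⇒⊆W↓ : {L : Pred (suc m)} → DirectlyRegular L → L ⊆ (L W↓)
  directlyRegular⇒⊆W↓ DR w l = l , Equivalence.to (DR w) l

module Mix {m : ℕ} (M K : Pred (suc m)) (hM : IsNormalInW⁺ M) (hK : IsNormalInW K) where
  open IsSubgroup

  private
    sM : IsSubgroup M
    sM = IsNormalInW⁺.subgroup hM

    sK : IsSubgroup K
    sK = IsNormalInW.subgroup hK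

  N : Pred (suc m)
  N = M ∩ K

  N⊆M : N ⊆ M
  N⊆M _ = proj₁

  M^r₀-normalises-M : Normalises (M ^r₀) M
  M^r₀-normalises-M g mg = IsNormalInW⁺.conj hM g (^r₀-⊆W⁺ (IsNormalInW⁺.inW⁺ hM) g mg)

  rightFactor : Elt (N W↑) → Elt (((M ^r₀) ∩ K) · M)
  rightFactor (_ , _ , b , _ , (mb , kb) , _) =
    b , b , [] , (mb , normalInW⇒^r₀⊆ hK b kb) , unit sM , ≡⇒~ (sym (++-identityʳ b))

  chiralityIso : Iso (N W↑) N (((M ^r₀) ∩ K) · M) M
  chiralityIso = record
    { f = rightFactor ; f-cong = f-cong ; f-hom = f-hom ; f-inj = f-inj ; f-surj = f-surj }
    where
    f-cong : ∀ x y → x ≈[ N ] y → rightFactor x ≈[ M ] rightFactor y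
    f-cong (_ , a , b , (ma , _) , _ , ex) (_ , a' , b' , (ma' , _) , _ , ey) (h , _) = resp sM
      (~-trans (~-cong (~-refl {u = a ⁻¹ʷ}) (~-cong (~-cong ex (⁻¹ʷ-resp-~ ey)) (~-refl {u = a'})))
        (solve (ι x₀ ⊕ ((x₀ ⊕ x₁) ⊕ ι (x₂ ⊕ x₃)) ⊕ x₂) (x₁ ⊕ ι x₃) refl (a ∷ b ∷ a' ∷ b' ∷ [])))
      (mul sM (inv sM ma) (mul sM h ma'))

    f-hom : ∀ (x y : Elt (N W↑)) (p : (N W↑) (proj₁ x ++ proj₁ y)) →
            M (proj₁ (rightFactor (proj₁ x ++ proj₁ y , p)) ++ (proj₁ (rightFactor x) ++ proj₁ (rightFactor y)) ⁻¹ʷ)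
    f-hom (_ , a , b , (ma , _) , (mb , _) , ex) (_ , a' , b' , (ma' , _) , _ , ey) (a'' , b'' , (ma'' , _) , _ , e) =
      resp sM
        (~-trans (solve (ι x₀ ⊕ x₁ ⊕ x₂ ⊕ x₃ ⊕ ι x₂) (ι x₀ ⊕ ((x₁ ⊕ x₂) ⊕ (x₃ ⊕ x₄)) ⊕ ι (x₂ ⊕ x₄))
                        refl (a'' ∷ a ∷ b ∷ a' ∷ b' ∷ []))
          (~-trans (around (~-trans (~-cong (~-sym ex) (~-sym ey)) e))
            (solve (ι x₀ ⊕ (x₀ ⊕ x₁) ⊕ ι (x₂ ⊕ x₃)) (x₁ ⊕ ι (x₂ ⊕ x₃)) refl (a'' ∷ b'' ∷ b ∷ b' ∷ []))))
        (mul sM (inv sM ma'') (mul sM ma (M^r₀-normalises-M b mb ma')))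
      where
      around : ∀ {u v} → u ~ v → (a'' ⁻¹ʷ ++ u ++ (b ++ b') ⁻¹ʷ) ~ (a'' ⁻¹ʷ ++ v ++ (b ++ b') ⁻¹ʷ)
      around p = ~-cong (~-refl {u = a'' ⁻¹ʷ}) (~-cong p (~-refl {u = (b ++ b') ⁻¹ʷ}))

    f-inj : ∀ x y → rightFactor x ≈[ M ] rightFactor y → x ≈[ N ] y
    f-inj (x , a , b , (ma , ka) , (_ , kb) , ex) (y , a' , b' , (ma' , ka') , (_ , kb') , ey) h =
      resp sM eq (mul sM ma (mul sM h (inv sM ma'))) ,
      resp sK eq (mul sK ka (mul sK (mul sK (normalInW⇒^r₀⊆ hK b kb) (inv sK (normalInW⇒^r₀⊆ hK b' kb'))) (inv sK ka')))
      where
      eq : (a ++ (b ++ b' ⁻¹ʷ) ++ a' ⁻¹ʷ) ~ (x ++ y ⁻¹ʷ)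
      eq = ~-trans (solve (x₀ ⊕ (x₁ ⊕ ι x₃) ⊕ ι x₂) ((x₀ ⊕ x₁) ⊕ ι (x₂ ⊕ x₃)) refl (a ∷ b ∷ a' ∷ b' ∷ []))
                   (~-cong (~-sym ex) (⁻¹ʷ-resp-~ (~-sym ey)))

    f-surj : ∀ y → Σ (Elt (N W↑)) λ x → rightFactor x ≈[ M ] y
    f-surj (w , c , l , (mc , kc) , ml , ew) =
      (c , [] , c , (unit sM , unit sK) , (mc , normalInW⇒⊆^r₀ hK c kc) , ~-refl) ,
      resp sM
        (~-sym (~-trans (~-cong (~-refl {u = c}) (⁻¹ʷ-resp-~ ew))
                        (solve (x₀ ⊕ ι (x₀ ⊕ x₁)) (x₀ ⊕ ι x₁ ⊕ ι x₀) refl (c ∷ l ∷ []))))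
        (M^r₀-normalises-M c mc (inv sM ml))

  chiralityGroup-normal : IsNormalSubgroupOf (((M ^r₀) ∩ K) · M) ((M ^r₀) · M)
  chiralityGroup-normal =
    ·-normal (∩-subgroup (^r₀-subgroup sM) sK) sM (λ _ → proj₁)
      (normalises-∩-normalInW (^r₀-subgroup sM) hK) M^r₀-normalises-M

lemma5p5 : (m : ℕ) → 2 ≤ m → (M K : Pred (suc m)) →
    IsNormalInW⁺ M → Chiral M → IsNormalInW K →
    Iso ((M ∩ K) W↑) (M ∩ K) (((M ^r₀) ∩ K) · M) M
    × IsNormalSubgroupOf (((M ^r₀) ∩ K) · M) ((M ^r₀) · M)
    × (TrivialQuot ((M ∩ K) W↑) (M ∩ K) ⇔ ((M ∩ K) ⊆ (M ^r₀)))
    × (DirectlyRegular (M ∩ K) → (M ∩ K) ⊆ (M W↓))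
lemma5p5 m _ M K hM _ hK =
  chiralityIso ,
  chiralityGroup-normal ,
  ⇔-trans (W↑-trivial⇔⊆^r₀ (∩-subgroup (IsNormalInW⁺.subgroup hM) (IsNormalInW.subgroup hK)))
          (∩-⊆^r₀⇔ (normalInW⇒⊆^r₀ hK)) ,
  λ DR w x → W↓-mono N⊆M w (directlyRegular⇒⊆W↓ DR w x)
  where open Mix M K hM hK
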